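{- Let $j, k$ be positive integers and suppose there exist positive integers $n < N$ such that every integer $m$ with $n < m < N$ is $(j,k)$-representable. If $a$ is a positive integer with $a^k - (a-1)^k < N - n$, then every integer $m'$ with $n+1 < m' < N + a^k$ is $(j+1,k)$-representable.
   Context: For positive integers $j,k$, a positive integer $n$ is called $(j,k)$-representable if $n = x_1^k + \cdots + x_j^k$ with all $x_i$ positive integers. -}

module Defs where

open import Data.Nat using (ℕ; _+_; _^_; _<_; NonZero)
open import Data.Fin using (Fin)
open import Data.Product using (Σ; _×_)
open import Relation.Binary.PropositionalEquality using (_≡_)

sumFin : (j : ℕ) → (Fin j → ℕ) → ℕ
sumFin Data.Nat.zero f = 0
sumFin (Data.Nat.suc j) f = f Fin.zero + sumFin j (λ i → f (Fin.suc i))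

Representable : ℕ → ℕ → ℕ → Set
Representable j k n =
  Σ (Fin j → ℕ) (λ x → ((i : Fin j) → 0 < x i) × (n ≡ sumFin j (λ i → x i ^ k)))

module Submission where

open import Defs
open import Data.Nat using (ℕ; zero; suc; _+_; _*_; _∸_; _^_; _≤_; _<_; z≤n; s≤s; _<?_)
open import Data.Nat.Properties
open import Data.Nat.Tactic.RingSolver using (solve-∀)
open import Data.Fin using (Fin)
open import Data.Product using (∃-syntax; _×_; _,_)
open import Relation.Nullary using (yes; no)
open import Relation.Binary.PropositionalEquality using (_≡_; refl; sym; cong; subst; subst₂)

-- Write m' = c ^ k + r with n < r < N.  Such a c ∈ [1, a] exists because the windows
-- (n + c ^ k, N + c ^ k) for c = 1, …, a overlap consecutively: their shift
-- (c + 1) ^ k − c ^ k grows with c (convexity of x ↦ x ^ k), so it is at most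
-- a ^ k − (a − 1) ^ k < N − n.  Together they cover (n + 1, N + a ^ k).

^-supermodular : ∀ k x d e → (x + d) ^ k + (x + e) ^ k ≤ (x + e + d) ^ k + x ^ k
^-supermodular zero    x d e = ≤-refl
^-supermodular (suc k) x d e =
  subst₂ _≤_ (sym (expandˡ x d e P Q)) (sym (expandʳ x d e R S))
    (+-mono-≤ (*-monoʳ-≤ x (^-supermodular k x d e))
              (+-mono-≤ (*-monoʳ-≤ d P≤R) (*-monoʳ-≤ e Q≤R)))
  where
  P = (x + d) ^ k
  Q = (x + e) ^ k
  R = (x + e + d) ^ k
  S = x ^ k
  P≤R : P ≤ R
  P≤R = ^-monoˡ-≤ k (+-monoˡ-≤ d (m≤m+n x e))
  Q≤R : Q ≤ R
  Q≤R = ^-monoˡ-≤ k (m≤m+n (x + e) d)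
  expandˡ : ∀ x d e P Q → (x + d) * P + (x + e) * Q ≡ x * (P + Q) + (d * P + e * Q)
  expandˡ = solve-∀
  expandʳ : ∀ x d e R S → (x + e + d) * R + x * S ≡ x * (R + S) + (d * R + e * R)
  expandʳ = solve-∀

^-increment-mono : ∀ k {b c} → b ≤ c → suc b ^ k + c ^ k ≤ suc c ^ k + b ^ k
^-increment-mono k {b} b≤c with m≤n⇒∃[o]m+o≡n b≤c
... | e , refl = subst₂ (λ u v → u ^ k + (b + e) ^ k ≤ v ^ k + b ^ k)
                   (+-comm b 1) (+-comm (b + e) 1) (^-supermodular k b 1 e)

sliding-window-cover : ∀ (f : ℕ → ℕ) n N a →
  (∀ c → c < a → n + f (suc c) < N + f c) →
  ∀ m → n + f 0 < m → m < N + f a → ∃[ c ] (n + f c < m × m < N + f c)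
sliding-window-cover f n N zero    steps m lo hi = 0 , lo , hi
sliding-window-cover f n N (suc a) steps m lo hi with n + f (suc a) <? m
... | yes lo′ = suc a , lo′ , hi
... | no  lo≮ = sliding-window-cover f n N a (λ c c<a → steps c (m<n⇒m<1+n c<a)) m lo
                  (≤-<-trans (≮⇒≥ lo≮) (steps a ≤-refl))

∸-window : ∀ {n N m b} → n + b < m → m < N + b → n < m ∸ b × m ∸ b < N
∸-window {n} {N} {m} {b} lo hi =
  subst (_< m ∸ b) (m+n∸n≡m n b) (∸-monoˡ-< lo (m≤n+m b n)) ,
  subst (m ∸ b <_) (m+n∸n≡m N b) (∸-monoˡ-< hi b≤m)
  where
  b≤m : b ≤ m
  b≤m = ≤-trans (m≤n+m b n) (<⇒≤ lo)

representable-cons : ∀ {j k r} c → 0 < c → Representable j k r →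
  Representable (suc j) k (c ^ k + r)
representable-cons {j} {k} c 0<c (xs , 0<xs , r≡) = x , 0<x , cong (c ^ k +_) r≡
  where
  x : Fin (suc j) → ℕ
  x Fin.zero    = c
  x (Fin.suc i) = xs i
  0<x : ∀ i → 0 < x i
  0<x Fin.zero    = 0<c
  0<x (Fin.suc i) = 0<xs i

∸<∸⇒+<+ : ∀ {x y n N} → y ≤ x → n ≤ N → x ∸ y < N ∸ n → n + x < N + y
∸<∸⇒+<+ {x} {y} {n} {N} y≤x n≤N gap = begin-strict
  n + x               ≡⟨ cong (n +_) (m∸n+n≡m y≤x) ⟨
  n + (x ∸ y + y)     ≡⟨ +-assoc n _ y ⟨
  n + (x ∸ y) + y     <⟨ +-monoˡ-< y (+-monoʳ-< n gap) ⟩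
  n + (N ∸ n) + y     ≡⟨ cong (_+ y) (m+[n∸m]≡n n≤N) ⟩
  N + y               ∎
  where open ≤-Reasoning

^-windows-overlap : ∀ k n N a → n + suc a ^ k < N + a ^ k →
  ∀ c → c < a → n + suc (suc c) ^ k < N + suc c ^ k
^-windows-overlap k n N a last c c<a = +-cancelʳ-< (a ^ k) _ _ (begin-strict
  n + suc (suc c) ^ k + a ^ k   ≡⟨ +-assoc n _ _ ⟩
  n + (suc (suc c) ^ k + a ^ k) ≤⟨ +-monoʳ-≤ n (^-increment-mono k c<a) ⟩
  n + (suc a ^ k + suc c ^ k)   ≡⟨ +-assoc n _ _ ⟨
  n + suc a ^ k + suc c ^ k     <⟨ +-monoˡ-< (suc c ^ k) last ⟩
  N + a ^ k + suc c ^ k         ≡⟨ +-assoc N _ _ ⟩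
  N + (a ^ k + suc c ^ k)       ≡⟨ cong (N +_) (+-comm (a ^ k) _) ⟩
  N + (suc c ^ k + a ^ k)       ≡⟨ +-assoc N _ _ ⟨
  N + suc c ^ k + a ^ k         ∎)
  where open ≤-Reasoning

theorem2p2 : (j k n N a : ℕ) → 0 < j → 0 < k → 0 < n → n < N →
    ((m : ℕ) → n < m → m < N → Representable j k m) →
    0 < a → a ^ k ∸ (a ∸ 1) ^ k < N ∸ n →
    (m' : ℕ) → suc n < m' → m' < N + a ^ k → Representable (suc j) k m'
theorem2p2 j k n N (suc a) _ _ _ n<N rep _ gap m' lo hi
  with sliding-window-cover (λ c → suc c ^ k) n N a
         (^-windows-overlap k n N a (∸<∸⇒+<+ (^-monoˡ-≤ k (n≤1+n a)) (<⇒≤ n<N) gap))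
         m' (subst (λ u → n + u < m') (sym (^-zeroˡ k)) (subst (_< m') (+-comm 1 n) lo)) hi
... | c , l , h with ∸-window l h
...   | n<r , r<N =
  subst (Representable (suc j) k) (m+[n∸m]≡n (≤-trans (m≤n+m _ n) (<⇒≤ l)))
    (representable-cons {k = k} (suc c) (s≤s z≤n) (rep (m' ∸ suc c ^ k) n<r r<N))
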